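{- Let $T_1,T_2$ be trees of orders $n(T_1)\ge 3$ and $n(T_2)\ge 3$, with $T_2$ rooted at some vertex. Then $$n(T_1)s(T_2)\le \gamma_{sp}(T_1\circ T_2)\le n(T_1)\big(n(T_2)-s(T_2)\big).$$
   Context: All graphs are finite, simple and undirected. $n(T)$ is the order of $T$ and $s(T)$ is the number of support vertices of $T$ (vertices adjacent to a vertex of degree one). A set $D$ of vertices of $G$ is a super dominating set if for every vertex $x\notin D$ there exists $u\in N_G(x)\cap D$ with $N_G(u)\subseteq D\cup\{x\}$; $\gamma_{sp}(G)$ is the minimum cardinality of a super dominating set. For $G$ with vertex set $\{v_1,\dots,v_n\}$ and $H$ with root $v$, the rooted product $G\circ H$ is obtained from one copy of $G$ and $n$ copies $H_1,\dots,H_n$ of $H$ by identifying each $v_i$ with the copy of $v$ in $H_i$. -}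

module Defs where

open import Data.Nat using (ℕ; zero; suc; _*_; _∸_; _≤_; _≥_)
open import Data.Fin using (Fin; remQuot; _≟_)
open import Data.Fin.Subset using (Subset; _∈_; _∉_; ∣_∣)
open import Data.Bool using (Bool; true; false; _∧_; _∨_)
open import Data.List using (List; []; _∷_; length; allFin)
open import Data.Bool.ListAction using (any)
open import Data.List.Relation.Unary.Unique.Propositional using (Unique)
open import Data.Vec using (tabulate)
open import Data.Product using (Σ; _×_; _,_; ∃)
open import Data.Sum using (_⊎_)
open import Relation.Nullary using (¬_)
open import Relation.Nullary.Decidable using (⌊_⌋)
open import Relation.Binary.PropositionalEquality using (_≡_)
open import Data.Nat using (_≡ᵇ_)

Adj : ℕ → Set
Adj n = Fin n → Fin n → Bool

IsSimple : ∀ {n} → Adj n → Set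
IsSimple {n} A = (∀ u v → A u v ≡ A v u) × (∀ v → A v v ≡ false)

data Walk {n} (A : Adj n) : Fin n → Fin n → Set where
  stay : ∀ u → Walk A u u
  step : ∀ {u w v} → A u w ≡ true → Walk A w v → Walk A u v

Connected : ∀ {n} → Adj n → Set
Connected {n} A = ∀ u v → Walk A u v

data Chain {n} (A : Adj n) : List (Fin n) → Set where
  []  : Chain A []
  [_] : ∀ u → Chain A (u ∷ [])
  _∷_ : ∀ {u w vs} → A u w ≡ true → Chain A (w ∷ vs) → Chain A (u ∷ w ∷ vs)

data Last {n} : List (Fin n) → Fin n → Set where
  here  : ∀ u → Last (u ∷ []) u
  there : ∀ {u w vs z} → Last (w ∷ vs) z → Last (u ∷ w ∷ vs) z

IsCycle : ∀ {n} → Adj n → List (Fin n) → Set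
IsCycle A [] = Data.Empty.⊥ where import Data.Empty
IsCycle {n} A (u ∷ vs) =
  (3 ≤ length (u ∷ vs)) × Unique (u ∷ vs) × Chain A (u ∷ vs)
    × Σ (Fin n) (λ z → Last (u ∷ vs) z × A z u ≡ true)

Acyclic : ∀ {n} → Adj n → Set
Acyclic {n} A = ∀ (cs : List (Fin n)) → ¬ IsCycle A cs

IsTree : ∀ {n} → Adj n → Set
IsTree A = IsSimple A × Connected A × Acyclic A

degree : ∀ {n} → Adj n → Fin n → ℕ
degree A v = ∣ tabulate (A v) ∣

isSupport : ∀ {n} → Adj n → Fin n → Bool
isSupport {n} A v = any (λ u → A v u ∧ (degree A u ≡ᵇ 1)) (allFin n)

supportCount : ∀ {n} → Adj n → ℕ
supportCount A = ∣ tabulate (isSupport A) ∣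

IsSuperDominating : ∀ {n} → Adj n → Subset n → Set
IsSuperDominating {n} A D =
  ∀ x → x ∉ D →
    Σ (Fin n) λ u → A x u ≡ true × u ∈ D ×
      (∀ w → A u w ≡ true → w ∈ D ⊎ w ≡ x)

-- Vertex set Fin (m * k); vertex c corresponds to (i , x) = remQuot k c,
-- meaning vertex x of the copy H_i; (i , r) is identified with v_i of G.
rootedProduct : ∀ {m k} → Adj m → Adj k → Fin k → Adj (m * k)
rootedProduct {m} {k} G H r c d with remQuot {m} k c | remQuot {m} k d
... | (i , x) | (j , y) =
  (⌊ i ≟ j ⌋ ∧ H x y) ∨ (⌊ x ≟ r ⌋ ∧ ⌊ y ≟ r ⌋ ∧ G i j)

module Submission where

-- In any undirected graph, sending each vertex outside a super
-- dominating set D to its dominating neighbour is injective, so ∣V∣ ≤ 2∣D∣.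
-- In a connected graph on at least three vertices no two leaves are adjacent,
-- so support vertices are not leaves and picking a leaf for each support
-- vertex is injective: 2 s(T₂) ≤ n(T₂).  Hence 2 n(T₁) s(T₂) ≤ n(T₁) n(T₂) ≤ 2∣D∣.
--
-- Fix one leaf of T₂ for each support vertex ("chosen" leaves)
-- and let D omit exactly the chosen leaves of every copy of T₂.  A chosen leaf
-- (i, ℓ) is super dominated by its support (i, v), whose only neighbour
-- outside D is (i, ℓ); and ∣D∣ ≤ n(T₁)(n(T₂) − s(T₂)).

open import Defs
open import Data.Nat using (ℕ; zero; suc; _+_; _*_; _∸_; _≤_; _≡ᵇ_; z≤n; s≤s)
open import Data.Nat.Properties
  using (≡ᵇ⇒≡; ≡⇒≡ᵇ; suc-injective; +-identityʳ; *-cancelˡ-≤;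
         *-distribˡ-+; *-distribˡ-∸; *-monoʳ-≤; +-mono-≤; +-monoʳ-≤; ∸-monoʳ-≤; m≤n+m∸n; m+[n∸m]≡n;
         module ≤-Reasoning)
open import Data.Fin using (Fin; zero; suc; _≟_; _↑ˡ_; _↑ʳ_; remQuot; combine)
open import Data.Fin.Properties using (remQuot-combine; combine-remQuot)
open import Data.Fin.Subset using (Subset; _∈_; _∉_; ∣_∣; _-_; ∁)
open import Data.Fin.Subset.Properties
  using (nonempty?; Empty-unique; ∣⊥∣≡0; p─⊥≡p; p─q⊆p; x∈p∧x≢y⇒x∈p-y; p⊆q⇒∣p∣≤∣q∣;
         ∣p∣≤n; ∣∁p∣≡n∸∣p∣; x∉p⇒x∈∁p; x∈∁p⇒x∉p; x∉∁p⇒x∈p)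
open import Data.Vec using (_∷_; here; there; tabulate)
open import Data.Vec.Properties using (lookup∘tabulate; lookup⇒[]=; []=⇒lookup; tabulate-cong)
open import Data.Bool using (Bool; true; false; _∧_; _∨_)
open import Data.Bool.Properties using (T-≡)
open import Data.Bool.ListAction using (any)
open import Data.List using (List; []; _∷_; allFin)
open import Data.List.Membership.Propositional using (lose)
open import Data.List.Membership.Propositional.Properties using (∈-allFin)
open import Data.List.Relation.Unary.Any.Properties using (any⁺)
open import Data.Product using (Σ; _×_; _,_; proj₁; proj₂)
open import Data.Sum using (_⊎_; inj₁; inj₂)
open import Data.Empty using (⊥; ⊥-elim)
open import Function using (_∘_; Equivalence)
open import Relation.Nullary using (yes; no; contradiction)
open import Relation.Nullary.Decidable using (⌊_⌋)
open import Relation.Binary.PropositionalEquality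
  using (_≡_; _≢_; refl; sym; trans; cong; cong₂; subst; subst₂; module ≡-Reasoning)

open Equivalence using (to; from)

∧-elimˡ : ∀ {a b} → a ∧ b ≡ true → a ≡ true
∧-elimˡ {true} _ = refl

∧-elimʳ : ∀ {a b} → a ∧ b ≡ true → b ≡ true
∧-elimʳ {true} e = e

∧-intro : ∀ {a b} → a ≡ true → b ≡ true → a ∧ b ≡ true
∧-intro refl refl = refl

∨-elim : ∀ {a b} → a ∨ b ≡ true → a ≡ true ⊎ b ≡ true
∨-elim {true}  _ = inj₁ refl
∨-elim {false} e = inj₂ e

∧-leftComm : ∀ a b c → a ∧ (b ∧ c) ≡ b ∧ (a ∧ c)
∧-leftComm true  b     c = refl
∧-leftComm false true  c = refl
∧-leftComm false false c = refl

≡ᵇ-true⇒≡ : ∀ {m n} → (m ≡ᵇ n) ≡ true → m ≡ n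
≡ᵇ-true⇒≡ {m} {n} = ≡ᵇ⇒≡ m n ∘ from T-≡

≡⇒≡ᵇ-true : ∀ {m n} → m ≡ n → (m ≡ᵇ n) ≡ true
≡⇒≡ᵇ-true {m} {n} = to T-≡ ∘ ≡⇒≡ᵇ m n

≟-true⇒≡ : ∀ {n} {a b : Fin n} → ⌊ a ≟ b ⌋ ≡ true → a ≡ b
≟-true⇒≡ {a = a} {b} e with a ≟ b
... | yes a≡b = a≡b

≟-sym : ∀ {n} (a b : Fin n) → ⌊ a ≟ b ⌋ ≡ ⌊ b ≟ a ⌋
≟-sym a b with a ≟ b | b ≟ a
... | yes _   | yes _   = refl
... | no  _   | no  _   = refl
... | yes a≡b | no  b≢a = contradiction (sym a≡b) b≢a
... | no  a≢b | yes b≡a = contradiction (sym b≡a) a≢b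

≟-refl : ∀ {n} (a : Fin n) → ⌊ a ≟ a ⌋ ≡ true
≟-refl a with a ≟ a
... | yes _   = refl
... | no  a≢a = contradiction refl a≢a

∈-tabulate⁺ : ∀ {n} (f : Fin n → Bool) {x} → f x ≡ true → x ∈ tabulate f
∈-tabulate⁺ f {x} fx = lookup⇒[]= x _ (trans (lookup∘tabulate f x) fx)

∈-tabulate⁻ : ∀ {n} (f : Fin n → Bool) {x} → x ∈ tabulate f → f x ≡ true
∈-tabulate⁻ f {x} x∈ = trans (sym (lookup∘tabulate f x)) ([]=⇒lookup x∈)

x∉p-x : ∀ {n} (p : Subset n) x → x ∉ p - x
x∉p-x (_ ∷ p) zero    ()
x∉p-x (_ ∷ p) (suc x) (there x∈) = x∉p-x p x x∈

∣p∣≡1+∣p-x∣ : ∀ {n} {p : Subset n} {x} → x ∈ p → ∣ p ∣ ≡ suc ∣ p - x ∣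
∣p∣≡1+∣p-x∣ {p = _ ∷ p}     here       = cong (suc ∘ ∣_∣) (sym (p─⊥≡p p))
∣p∣≡1+∣p-x∣ {p = true ∷ p}  (there x∈) = cong suc (∣p∣≡1+∣p-x∣ x∈)
∣p∣≡1+∣p-x∣ {p = false ∷ p} (there x∈) = ∣p∣≡1+∣p-x∣ x∈

injection⇒∣p∣≤∣q∣ : ∀ {m n} {p : Subset m} {q : Subset n} (f : ∀ {x} → x ∈ p → Fin n) →
  (∀ {x} (x∈ : x ∈ p) → f x∈ ∈ q) →
  (∀ {x y} (x∈ : x ∈ p) (y∈ : y ∈ p) → f x∈ ≡ f y∈ → x ≡ y) →
  ∣ p ∣ ≤ ∣ q ∣
injection⇒∣p∣≤∣q∣ {p = p} f into injective = count ∣ p ∣ refl f into injective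
  where
  count : ∀ {m n} k {p : Subset m} {q : Subset n} → ∣ p ∣ ≡ k → (f : ∀ {x} → x ∈ p → Fin n) →
    (∀ {x} (x∈ : x ∈ p) → f x∈ ∈ q) →
    (∀ {x y} (x∈ : x ∈ p) (y∈ : y ∈ p) → f x∈ ≡ f y∈ → x ≡ y) → k ≤ ∣ q ∣
  count zero _ _ _ _ = z≤n
  count {m} {n} (suc k) {p} {q} ∣p∣≡1+k f into injective with nonempty? p
  ... | no empty = contradiction (trans (sym ∣p∣≡1+k) (trans (cong ∣_∣ (Empty-unique empty)) (∣⊥∣≡0 m))) λ ()
  ... | yes (x , x∈p) = begin
      suc k                ≤⟨ s≤s (count k ∣p-x∣≡k f′ into′ injective′) ⟩
      suc ∣ q - f x∈p ∣    ≡⟨ ∣p∣≡1+∣p-x∣ (into x∈p) ⟨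
      ∣ q ∣                ∎
    where
    open ≤-Reasoning
    ∣p-x∣≡k : ∣ p - x ∣ ≡ k
    ∣p-x∣≡k = suc-injective (trans (sym (∣p∣≡1+∣p-x∣ x∈p)) ∣p∣≡1+k)
    f′ : ∀ {y} → y ∈ p - x → Fin n
    f′ y∈ = f (p─q⊆p p _ y∈)
    injective′ : ∀ {y z} (y∈ : y ∈ p - x) (z∈ : z ∈ p - x) → f′ y∈ ≡ f′ z∈ → y ≡ z
    injective′ y∈ z∈ = injective (p─q⊆p p _ y∈) (p─q⊆p p _ z∈)
    into′ : ∀ {y} (y∈ : y ∈ p - x) → f′ y∈ ∈ q - f x∈p
    into′ y∈ = x∈p∧x≢y⇒x∈p-y (into (p─q⊆p p _ y∈)) λ fy≡fx →
      x∉p-x p x (subst (_∈ p - x) (injective (p─q⊆p p _ y∈) x∈p fy≡fx) y∈)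

∣tabulate∣-++ : ∀ k l (f : Fin (k + l) → Bool) →
  ∣ tabulate f ∣ ≡ ∣ tabulate (f ∘ (_↑ˡ l)) ∣ + ∣ tabulate (f ∘ (k ↑ʳ_)) ∣
∣tabulate∣-++ zero    l f = refl
∣tabulate∣-++ (suc k) l f with f zero
... | true  = cong suc (∣tabulate∣-++ k l (f ∘ suc))
... | false = ∣tabulate∣-++ k l (f ∘ suc)

∣rowConstant∣ : ∀ m {k} (g : Fin (m * k) → Bool) (p : Fin k → Bool) →
  (∀ (i : Fin m) x → g (combine i x) ≡ p x) → ∣ tabulate g ∣ ≡ m * ∣ tabulate p ∣
∣rowConstant∣ zero    g p _ = refl
∣rowConstant∣ (suc m) {k} g p g≡p = begin
  ∣ tabulate g ∣                                          ≡⟨ ∣tabulate∣-++ k (m * k) g ⟩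
  ∣ tabulate (g ∘ (_↑ˡ (m * k))) ∣ + ∣ tabulate (g ∘ (k ↑ʳ_)) ∣
    ≡⟨ cong₂ _+_ (cong ∣_∣ (tabulate-cong (g≡p zero))) (∣rowConstant∣ m (g ∘ (k ↑ʳ_)) p (g≡p ∘ suc)) ⟩
  ∣ tabulate p ∣ + m * ∣ tabulate p ∣                     ∎
  where open ≡-Reasoning

halve-≤ : ∀ {a b} → a + a ≤ b + b → a ≤ b
halve-≤ {a} {b} = *-cancelˡ-≤ 2 ∘ subst₂ _≤_ (double a) (double b)
  where
  double : ∀ c → c + c ≡ 2 * c
  double c = cong (c +_) (sym (+-identityʳ c))

-- Sending each x ∉ D to its
-- dominating neighbour u is injective, since x is the only neighbour of u
-- outside D; so ∣ ∁ D ∣ ≤ ∣ D ∣.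
superDominating⇒half : ∀ {n} (A : Adj n) → (∀ u v → A u v ≡ A v u) →
  (D : Subset n) → IsSuperDominating A D → n ≤ ∣ D ∣ + ∣ D ∣
superDominating⇒half {n} A symmetric D superDom = begin
  n                      ≤⟨ m≤n+m∸n n ∣ D ∣ ⟩
  ∣ D ∣ + (n ∸ ∣ D ∣)    ≡⟨ cong (∣ D ∣ +_) (∣∁p∣≡n∸∣p∣ D) ⟨
  ∣ D ∣ + ∣ ∁ D ∣        ≤⟨ +-monoʳ-≤ ∣ D ∣ (injection⇒∣p∣≤∣q∣ dominator inD injective) ⟩
  ∣ D ∣ + ∣ D ∣          ∎
  where
  open ≤-Reasoning
  dominator : ∀ {x} → x ∈ ∁ D → Fin n
  dominator {x} x∈ = proj₁ (superDom x (x∈∁p⇒x∉p x∈))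
  inD : ∀ {x} (x∈ : x ∈ ∁ D) → dominator x∈ ∈ D
  inD {x} x∈ = proj₁ (proj₂ (proj₂ (superDom x (x∈∁p⇒x∉p x∈))))
  injective : ∀ {x y} (x∈ : x ∈ ∁ D) (y∈ : y ∈ ∁ D) → dominator x∈ ≡ dominator y∈ → x ≡ y
  injective {x} {y} x∈ y∈ same with superDom x (x∈∁p⇒x∉p x∈) | superDom y (x∈∁p⇒x∉p y∈)
  ... | u , _ , _ , private-u | u′ , y~u′ , _ , _
    with private-u y (trans (symmetric u y) (subst (λ w → A y w ≡ true) (sym same) y~u′))
  ...   | inj₁ y∈D = contradiction y∈D (x∈∁p⇒x∉p y∈)
  ...   | inj₂ y≡x = sym y≡x

leaf-uniqueNeighbour : ∀ {n} (A : Adj n) {u v w} → degree A u ≡ 1 →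
  A u v ≡ true → A u w ≡ true → v ≡ w
leaf-uniqueNeighbour A {u} {v} {w} deg≡1 u~v u~w with v ≟ w
... | yes v≡w = v≡w
... | no  v≢w = contradiction deg≥2 λ ()
  where
  w∈ : w ∈ tabulate (A u) - v
  w∈ = x∈p∧x≢y⇒x∈p-y (∈-tabulate⁺ (A u) u~w) (v≢w ∘ sym)
  deg≥2 : 1 ≡ suc (suc ∣ tabulate (A u) - v - w ∣)
  deg≥2 = trans (sym deg≡1) (trans (∣p∣≡1+∣p-x∣ (∈-tabulate⁺ (A u) u~v)) (cong suc (∣p∣≡1+∣p-x∣ w∈)))

leafEdge-closed : ∀ {n} (A : Adj n) → (∀ u v → A u v ≡ A v u) →
  ∀ {u v} → A u v ≡ true → degree A u ≡ 1 → degree A v ≡ 1 →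
  ∀ {a b} → a ≡ u ⊎ a ≡ v → Walk A a b → b ≡ u ⊎ b ≡ v
leafEdge-closed A symmetric u~v leaf-u leaf-v at (stay _) = at
leafEdge-closed A symmetric u~v leaf-u leaf-v (inj₁ refl) (step u~w walk) =
  leafEdge-closed A symmetric u~v leaf-u leaf-v (inj₂ (leaf-uniqueNeighbour A leaf-u u~w u~v)) walk
leafEdge-closed A symmetric {u} {v} u~v leaf-u leaf-v (inj₂ refl) (step v~w walk) =
  leafEdge-closed A symmetric u~v leaf-u leaf-v
    (inj₁ (leaf-uniqueNeighbour A leaf-v v~w (trans (symmetric v u) u~v))) walk

thirdVertex : ∀ {n} → 3 ≤ n → (u v : Fin n) → Σ (Fin n) λ w → w ≢ u × w ≢ v
thirdVertex (s≤s (s≤s (s≤s _))) u v with zero ≟ u | zero ≟ v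
... | no 0≢u   | no 0≢v   = zero , 0≢u , 0≢v
... | yes refl | yes refl = suc zero , (λ ()) , (λ ())
... | yes refl | no _ with suc zero ≟ v
...   | no 1≢v   = suc zero , (λ ()) , 1≢v
...   | yes refl = suc (suc zero) , (λ ()) , (λ ())
thirdVertex (s≤s (s≤s (s≤s _))) u v | no _ | yes refl with suc zero ≟ u
...   | no 1≢u   = suc zero , 1≢u , (λ ())
...   | yes refl = suc (suc zero) , (λ ()) , (λ ())

-- In a connected graph with at least three vertices no two leaves are
-- adjacent: a walk to a third vertex would have to leave their edge.
noAdjacentLeaves : ∀ {n} (A : Adj n) → 3 ≤ n → (∀ u v → A u v ≡ A v u) → Connected A →
  ∀ {u v} → A u v ≡ true → degree A u ≡ 1 → degree A v ≡ 1 → ⊥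
noAdjacentLeaves A n≥3 symmetric connected {u} {v} u~v leaf-u leaf-v
  with thirdVertex n≥3 u v
... | w , w≢u , w≢v with leafEdge-closed A symmetric u~v leaf-u leaf-v (inj₁ refl) (connected u w)
...   | inj₁ w≡u = w≢u w≡u
...   | inj₂ w≡v = w≢v w≡v

firstSatisfying : ∀ {A : Set} → (A → Bool) → List A → A → A
firstSatisfying g []       d = d
firstSatisfying g (x ∷ xs) d with g x
... | true  = x
... | false = firstSatisfying g xs d

firstSatisfying-correct : ∀ {A : Set} (g : A → Bool) xs d → any g xs ≡ true →
  g (firstSatisfying g xs d) ≡ true
firstSatisfying-correct g (x ∷ xs) d any≡true with g x in gx
... | true  = gx
... | false = firstSatisfying-correct g xs d any≡true

any-intro : ∀ {n} (g : Fin n → Bool) {z} → g z ≡ true → any g (allFin n) ≡ true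
any-intro g {z} gz = to T-≡ (any⁺ g (lose (∈-allFin z) (from T-≡ gz)))

module Support {n} (H : Adj n) (n≥3 : 3 ≤ n) (symmetric : ∀ u v → H u v ≡ H v u)
                   (connected : Connected H) where

  isLeaf : Fin n → Bool
  isLeaf u = degree H u ≡ᵇ 1

  leafOf : Fin n → Fin n
  leafOf v = firstSatisfying (λ u → H v u ∧ isLeaf u) (allFin n) v

  leafOf-correct : ∀ {v} → isSupport H v ≡ true → H v (leafOf v) ≡ true × degree H (leafOf v) ≡ 1
  leafOf-correct {v} supp =
    ∧-elimˡ found , ≡ᵇ-true⇒≡ (∧-elimʳ found)
    where found = firstSatisfying-correct (λ u → H v u ∧ isLeaf u) (allFin n) v supp

  support⇒¬leaf : ∀ {v} → isSupport H v ≡ true → degree H v ≢ 1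
  support⇒¬leaf supp leaf-v =
    noAdjacentLeaves H n≥3 symmetric connected (proj₁ (leafOf-correct supp)) leaf-v (proj₂ (leafOf-correct supp))

  leafOf-soleNeighbour : ∀ {v w} → isSupport H v ≡ true → H (leafOf v) w ≡ true → w ≡ v
  leafOf-soleNeighbour {v} supp ℓ~w =
    leaf-uniqueNeighbour H (proj₂ (leafOf-correct supp)) ℓ~w (trans (symmetric _ v) (proj₁ (leafOf-correct supp)))

  leafOf-injective : ∀ {v v′} → isSupport H v ≡ true → isSupport H v′ ≡ true → leafOf v ≡ leafOf v′ → v ≡ v′
  leafOf-injective {v} supp supp′ same =
    leafOf-soleNeighbour supp′ (subst (λ ℓ → H ℓ v ≡ true) same (trans (symmetric _ v) (proj₁ (leafOf-correct supp))))

  -- 2 s(H) ≤ n(H): there are at least as many leaves as support vertices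
  -- (leafOf is injective), and no support vertex is a leaf.
  twice-supportCount≤order : supportCount H + supportCount H ≤ n
  twice-supportCount≤order = begin
    ∣ S ∣ + ∣ S ∣            ≤⟨ +-mono-≤ S≤L S≤∁L ⟩
    ∣ L ∣ + ∣ ∁ L ∣          ≡⟨ cong (∣ L ∣ +_) (∣∁p∣≡n∸∣p∣ L) ⟩
    ∣ L ∣ + (n ∸ ∣ L ∣)      ≡⟨ m+[n∸m]≡n (∣p∣≤n L) ⟩
    n                        ∎
    where
    open ≤-Reasoning
    S L : Subset n
    S = tabulate (isSupport H)
    L = tabulate isLeaf
    S≤L : ∣ S ∣ ≤ ∣ L ∣
    S≤L = injection⇒∣p∣≤∣q∣ (λ {v} _ → leafOf v)
      (λ v∈ → ∈-tabulate⁺ isLeaf (≡⇒≡ᵇ-true (proj₂ (leafOf-correct (∈-tabulate⁻ _ v∈)))))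
      (λ v∈ v′∈ → leafOf-injective (∈-tabulate⁻ _ v∈) (∈-tabulate⁻ _ v′∈))
    S≤∁L : ∣ S ∣ ≤ ∣ ∁ L ∣
    S≤∁L = p⊆q⇒∣p∣≤∣q∣ λ v∈ → x∉p⇒x∈∁p λ v∈L →
      support⇒¬leaf (∈-tabulate⁻ _ v∈) (≡ᵇ-true⇒≡ (∈-tabulate⁻ isLeaf v∈L))

  supportOfChosen : Fin n → Fin n → Bool
  supportOfChosen y v = isSupport H v ∧ ⌊ leafOf v ≟ y ⌋

  chosen : Fin n → Bool
  chosen y = any (supportOfChosen y) (allFin n)

  chosen⇒leafOf : ∀ {y} → chosen y ≡ true → Σ (Fin n) λ v → isSupport H v ≡ true × leafOf v ≡ y
  chosen⇒leafOf {y} chosen-y = v , ∧-elimˡ found , ≟-true⇒≡ (∧-elimʳ found)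
    where
    v = firstSatisfying (supportOfChosen y) (allFin n) y
    found = firstSatisfying-correct (supportOfChosen y) (allFin n) y chosen-y

  support⇒¬chosen : ∀ {v} → isSupport H v ≡ true → chosen v ≡ false
  support⇒¬chosen {v} supp with chosen v in chosen-v
  ... | false = refl
  ... | true with chosen⇒leafOf chosen-v
  ...   | v′ , supp′ , refl = ⊥-elim (support⇒¬leaf supp (proj₂ (leafOf-correct supp′)))

  supportCount≤∣chosen∣ : supportCount H ≤ ∣ tabulate chosen ∣
  supportCount≤∣chosen∣ = injection⇒∣p∣≤∣q∣ (λ {v} _ → leafOf v)
    (λ {v} v∈ → ∈-tabulate⁺ chosen (any-intro (supportOfChosen (leafOf v)) (∧-intro (∈-tabulate⁻ _ v∈) (≟-refl (leafOf v)))))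
    (λ v∈ v′∈ → leafOf-injective (∈-tabulate⁻ _ v∈) (∈-tabulate⁻ _ v′∈))

module RootedProduct {m k} (G : Adj m) (H : Adj k) (r : Fin k) where

  RP : Adj (m * k)
  RP = rootedProduct G H r

  data Cell : Fin (m * k) → Set where
    cell : ∀ (i : Fin m) (x : Fin k) → Cell (combine i x)

  cellOf : ∀ c → Cell c
  cellOf c = subst Cell (combine-remQuot {m} k c) (cell _ _)

  adjacency : ∀ (i : Fin m) x j y → RP (combine i x) (combine j y) ≡ (⌊ i ≟ j ⌋ ∧ H x y) ∨ (⌊ x ≟ r ⌋ ∧ ⌊ y ≟ r ⌋ ∧ G i j)
  adjacency i x j y = cong₂ edge (remQuot-combine {m} {k} i x) (remQuot-combine {m} {k} j y)
    where
    edge : Fin m × Fin k → Fin m × Fin k → Bool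
    edge (i , x) (j , y) = (⌊ i ≟ j ⌋ ∧ H x y) ∨ (⌊ x ≟ r ⌋ ∧ ⌊ y ≟ r ⌋ ∧ G i j)

  RP-symmetric : (∀ i j → G i j ≡ G j i) → (∀ x y → H x y ≡ H y x) → ∀ c d → RP c d ≡ RP d c
  RP-symmetric symG symH c d with cellOf c | cellOf d
  ... | cell i x | cell j y = begin
    RP (combine i x) (combine j y)                          ≡⟨ adjacency i x j y ⟩
    (⌊ i ≟ j ⌋ ∧ H x y) ∨ (⌊ x ≟ r ⌋ ∧ ⌊ y ≟ r ⌋ ∧ G i j)
      ≡⟨ cong₂ _∨_ (cong₂ _∧_ (≟-sym i j) (symH x y))
                   (trans (∧-leftComm ⌊ x ≟ r ⌋ ⌊ y ≟ r ⌋ (G i j)) (cong (λ b → ⌊ y ≟ r ⌋ ∧ ⌊ x ≟ r ⌋ ∧ b) (symG i j))) ⟩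
    (⌊ j ≟ i ⌋ ∧ H y x) ∨ (⌊ y ≟ r ⌋ ∧ ⌊ x ≟ r ⌋ ∧ G j i)  ≡⟨ adjacency j y i x ⟨
    RP (combine j y) (combine i x)                          ∎
    where open ≡-Reasoning

module Bounds {m k} (G : Adj m) (H : Adj k) (r : Fin k) (k≥3 : 3 ≤ k)
              (symG : ∀ i j → G i j ≡ G j i) (symH : ∀ x y → H x y ≡ H y x)
              (connH : Connected H) where
  open RootedProduct G H r
  open Support H k≥3 symH connH

  lowerBound : (D : Subset (m * k)) → IsSuperDominating RP D → m * supportCount H ≤ ∣ D ∣
  lowerBound D superDom = halve-≤ (begin
    m * s + m * s     ≡⟨ *-distribˡ-+ m s s ⟨
    m * (s + s)       ≤⟨ *-monoʳ-≤ m twice-supportCount≤order ⟩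
    m * k             ≤⟨ superDominating⇒half RP (RP-symmetric symG symH) D superDom ⟩
    ∣ D ∣ + ∣ D ∣     ∎)
    where
    open ≤-Reasoning
    s = supportCount H

  isChosenLeaf : Fin (m * k) → Bool
  isChosenLeaf c = chosen (proj₂ (remQuot {m} k c))

  isChosenLeaf-cell : ∀ i y → isChosenLeaf (combine i y) ≡ chosen y
  isChosenLeaf-cell i y = cong (chosen ∘ proj₂) (remQuot-combine {m} {k} i y)

  D : Subset (m * k)
  D = ∁ (tabulate isChosenLeaf)

  unchosen⇒∈D : ∀ {j z} → chosen z ≡ false → combine j z ∈ D
  unchosen⇒∈D {j} {z} unchosen = x∉p⇒x∈∁p λ c∈ →
    contradiction (trans (sym unchosen) (trans (sym (isChosenLeaf-cell j z)) (∈-tabulate⁻ isChosenLeaf c∈))) λ ()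

  ∣D∣≤ : ∣ D ∣ ≤ m * (k ∸ supportCount H)
  ∣D∣≤ = begin
    ∣ D ∣                                    ≡⟨ ∣∁p∣≡n∸∣p∣ (tabulate isChosenLeaf) ⟩
    m * k ∸ ∣ tabulate isChosenLeaf ∣        ≡⟨ cong (m * k ∸_) (∣rowConstant∣ m isChosenLeaf chosen isChosenLeaf-cell) ⟩
    m * k ∸ m * ∣ tabulate chosen ∣          ≤⟨ ∸-monoʳ-≤ (m * k) (*-monoʳ-≤ m supportCount≤∣chosen∣) ⟩
    m * k ∸ m * supportCount H               ≡⟨ *-distribˡ-∸ m k (supportCount H) ⟨
    m * (k ∸ supportCount H)                 ∎
    where open ≤-Reasoning

  -- The copy (i , v) of a support vertex v lies in D and super dominates the
  -- copy (i , leafOf v) of its chosen leaf: its only neighbour outside D is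
  -- that leaf, since a chosen neighbour in copy i must be leafOf v itself, and
  -- an edge through the roots would make the support vertex v a leaf.
  dominatesLeaf : ∀ i {v} → isSupport H v ≡ true → ∀ {w} → RP (combine i v) w ≡ true →
    w ∈ D ⊎ w ≡ combine i (leafOf v)
  dominatesLeaf i {v} supp {w} edge with cellOf w
  ... | cell j z with chosen z in chosen-z
  ...   | false = inj₁ (unchosen⇒∈D chosen-z)
  ...   | true with chosen⇒leafOf chosen-z
  ...     | v′ , supp′ , refl with ∨-elim (trans (sym (adjacency i v j (leafOf v′))) edge)
  ...       | inj₁ sameCopy = inj₂ (cong₂ combine (sym i≡j) (cong leafOf (sym v≡v′)))
    where
    i≡j : i ≡ j
    i≡j = ≟-true⇒≡ (∧-elimˡ sameCopy)
    v≡v′ : v ≡ v′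
    v≡v′ = leafOf-soleNeighbour supp′ (trans (symH _ v) (∧-elimʳ sameCopy))
  ...       | inj₂ viaRoots = ⊥-elim (support⇒¬leaf supp (subst (λ u → degree H u ≡ 1) ℓ≡v (proj₂ (leafOf-correct supp′))))
    where
    ℓ≡v : leafOf v′ ≡ v
    ℓ≡v = trans (≟-true⇒≡ (∧-elimˡ (∧-elimʳ {a = ⌊ v ≟ r ⌋} viaRoots))) (sym (≟-true⇒≡ (∧-elimˡ viaRoots)))

  superDominating : IsSuperDominating RP D
  superDominating x x∉D with cellOf x
  ... | cell i y with chosen⇒leafOf (trans (sym (isChosenLeaf-cell i y)) (∈-tabulate⁻ isChosenLeaf (x∉∁p⇒x∈p x∉D)))
  ...   | v , supp , refl =
    combine i v , leaf~support , unchosen⇒∈D (support⇒¬chosen supp) , λ _ → dominatesLeaf i supp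
    where
    leaf~support : RP (combine i (leafOf v)) (combine i v) ≡ true
    leaf~support = begin
      RP (combine i (leafOf v)) (combine i v)   ≡⟨ adjacency i (leafOf v) i v ⟩
      (⌊ i ≟ i ⌋ ∧ H (leafOf v) v) ∨ viaRoots   ≡⟨ cong₂ (λ a b → (a ∧ b) ∨ viaRoots) (≟-refl i) leaf~v ⟩
      true                                      ∎
      where
      open ≡-Reasoning
      viaRoots : Bool
      viaRoots = ⌊ leafOf v ≟ r ⌋ ∧ ⌊ v ≟ r ⌋ ∧ G i i
      leaf~v : H (leafOf v) v ≡ true
      leaf~v = trans (symH _ v) (proj₁ (leafOf-correct supp))

mainTheorem14 : ∀ {n₁ n₂ : ℕ} (T₁ : Adj n₁) (T₂ : Adj n₂) (r : Fin n₂) →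
    3 ≤ n₁ → 3 ≤ n₂ → IsTree T₁ → IsTree T₂ →
    ((D : Subset (n₁ * n₂)) → IsSuperDominating (rootedProduct T₁ T₂ r) D →
        n₁ * supportCount T₂ ≤ ∣ D ∣)
    × Σ (Subset (n₁ * n₂)) (λ D → IsSuperDominating (rootedProduct T₁ T₂ r) D
        × ∣ D ∣ ≤ n₁ * (n₂ ∸ supportCount T₂))
mainTheorem14 T₁ T₂ r _ n₂≥3 ((sym₁ , _) , _) ((sym₂ , _) , connected₂ , _) =
  lowerBound , (D , superDominating , ∣D∣≤)
  where open Bounds T₁ T₂ r n₂≥3 sym₁ sym₂ connected₂
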